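{- Let $\mathcal{C}=(X_1,\dots,X_k)$ be a collection of itemsets over items $A=\{a_1,\dots,a_N\}$, and let $\mathcal{T}_{\mathcal{C}}$ be the corresponding partition of $\mathcal{T}=\{0,1\}^N$. Run the following procedure (QieBlockSizes). First, for each block $T\in\mathcal{T}_{\mathcal{C}}$, set $e(T)\leftarrow 2^{N-|I_T|}$ where $I_T=\bigcup\{X: X\in\mathrm{sets}(T;\mathcal{C})\}$. Then for $i=1,\dots,k$ and for each block $T\in\mathcal{T}_{\mathcal{C}}$: let $\mathcal{G}=\mathrm{sets}(T;\mathcal{C})$; if $X_i\notin\mathcal{G}$, let $\mathcal{G}'=\mathrm{closure}(\mathcal{G}\cup\{X_i\},i-1)$ and $T'=\mathrm{block}(\mathcal{G}')$, and if $T'\neq\emptyset$ set $e(T)\leftarrow e(T)-e(T')$. Then at termination, $e(T)$ equals the number of transactions in $T$, for every $T\in\mathcal{T}_{\mathcal{C}}$.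
   Context: For an itemset $X\subseteq A$, $S_X(t)=1$ iff $t_i=1$ for all $a_i\in X$. The collection $\mathcal{C}$ partitions $\mathcal{T}$ into blocks: $t_1,t_2$ lie in the same block iff $S_X(t_1)=S_X(t_2)$ for all $X\in\mathcal{C}$; $\mathcal{T}_{\mathcal{C}}$ denotes this partition and $S_X(T)$ the common value on block $T$. $\mathrm{sets}(T;\mathcal{C})=\{X\in\mathcal{C}:S_X(T)=1\}$. For $\mathcal{G}\subseteq\mathcal{C}$: $\mathrm{closure}(\mathcal{G})=\{X\in\mathcal{C}: X\subseteq\bigcup_{Y\in\mathcal{G}}Y\}$; the $j$-prefix is $\mathcal{C}_j=\{X_1,\dots,X_j\}$; the $j$-closure is $\mathrm{closure}(\mathcal{G},j)=\mathcal{G}\cup(\mathrm{closure}(\mathcal{G})\setminus\mathcal{C}_j)$. $\mathrm{block}(\mathcal{G})$ is the block $T\in\mathcal{T}_{\mathcal{C}}$ with $\mathrm{sets}(T;\mathcal{C})=\mathcal{G}$ if $\mathrm{closure}(\mathcal{G})=\mathcal{G}$ (such a block exists and is unique), and is $\emptyset$ otherwise. -}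

module Defs where

open import Data.Nat using (ℕ; zero; suc; _∸_; _^_; _<ᵇ_)
open import Data.Integer using (ℤ; +_; _-_)
open import Data.Bool using (Bool; true; false; if_then_else_; _∨_; _∧_; not)
import Data.Bool as B
open import Data.Fin using (Fin; toℕ)
open import Data.Fin.Subset using (Subset; _∪_; ⁅_⁆; ∣_∣; ⋃)
open import Data.Fin.Subset.Properties using (_⊆?_)
open import Data.Vec using (Vec; []; _∷_; lookup; tabulate)
open import Data.Vec.Properties using (≡-dec)
open import Data.List using (List; []; _∷_; map; _++_; filter; length; foldl; allFin)
open import Relation.Nullary.Decidable using (⌊_⌋)
open import Relation.Binary.PropositionalEquality using (_≡_)

-- Items are Fin N; an itemset is a Subset N; a transaction t ∈ {0,1}^N is
-- also a Subset N (t_i = 1 iff item i is inside t).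
-- A collection C = (X_1,…,X_k) is a Vec (Subset N) k, 0-based index j ↦ X_{j+1}.
-- Subcollections G ⊆ C are represented as index sets Subset k.

Collection : ℕ → ℕ → Set
Collection N k = Vec (Subset N) k

S : ∀ {N} → Subset N → Subset N → Bool
S X t = ⌊ X ⊆? t ⌋

-- sets(t; C) : indices j with S_{X_j}(t) = 1   (this identifies the block of t)
sets : ∀ {N k} → Collection N k → Subset N → Subset k
sets C t = tabulate (λ j → S (lookup C j) t)

members : ∀ {N k} → Collection N k → Subset k → List (Subset N)
members {k = k} C G = map (lookup C) (filter (λ j → lookup G j B.≟ true) (allFin k))

union : ∀ {N k} → Collection N k → Subset k → Subset N
union C G = ⋃ (members C G)

closure : ∀ {N k} → Collection N k → Subset k → Subset k
closure C G = tabulate (λ j → ⌊ lookup C j ⊆? union C G ⌋)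

-- membership in the prefix C_j = {X_1,…,X_j}: 0-based index m with toℕ m < j
inPrefix : ∀ {k} → ℕ → Fin k → Bool
inPrefix j m = toℕ m <ᵇ j

jclosure : ∀ {N k} → Collection N k → Subset k → ℕ → Subset k
jclosure C G j = tabulate (λ m → lookup G m ∨ (lookup (closure C G) m ∧ not (inPrefix j m)))

-- block(G) ≠ ∅ iff closure(G) = G
isClosed : ∀ {N k} → Collection N k → Subset k → Bool
isClosed C G = ⌊ ≡-dec B._≟_ (closure C G) G ⌋

-- the estimates e, indexed by the sets(T;C) of a block T
Estimate : ℕ → Set
Estimate k = Subset k → ℤ

initE : ∀ {N k} → Collection N k → Estimate k
initE {N} C G = + (2 ^ (N ∸ ∣ union C G ∣))

-- one round for the (0-based) index i, i.e. the paper's X_{i+1}; the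
-- paper's (i+1)-1 = i prefix is used in the j-closure.
-- Within a round the updated blocks T (X_i ∉ sets T) are never read
-- (T' has X_i ∈ sets T'), so a simultaneous update is the same as the
-- sequential one.
step : ∀ {N k} → Collection N k → Fin k → Estimate k → Estimate k
step C i e G =
  if lookup G i then e G
  else (let G' = jclosure C (G ∪ ⁅ i ⁆) (toℕ i) in
        if isClosed C G' then e G - e G' else e G)

qieBlockSizes : ∀ {N k} → Collection N k → Estimate k
qieBlockSizes {k = k} C = foldl (λ e i → step C i e) (initE C) (allFin k)

allTransactions : (N : ℕ) → List (Subset N)
allTransactions zero = [] ∷ []
allTransactions (suc N) =
  map (true ∷_) (allTransactions N) ++ map (false ∷_) (allTransactions N)

blockSize : ∀ {N k} → Collection N k → Subset k → ℕ
blockSize {N} C G = length (filter (λ t → ≡-dec B._≟_ (sets C t) G) (allTransactions N))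

-- After the rounds for X_1, …, X_n, the estimate of a block G counts the
-- transactions t with G ⊆ sets(t) whose sets among X_1, …, X_n are exactly
-- those of G. Initially this is the number of t containing ⋃ G, namely
-- 2^(N - |⋃ G|). In round n + 1 with X_{n+1} ∉ G, the transactions counted
-- for G that also contain X_{n+1} are exactly those counted for
-- G′ = closure(G ∪ {X_{n+1}}, n); there are none unless G′ is closed, and
-- subtracting e(G′) leaves the count for n + 1. After all k rounds the
-- condition says sets(t) = G.
module Submission where

open import Defs
open import Data.Nat using (ℕ)
open import Data.Integer using (+_)
open import Data.Fin using (Fin)
open import Data.Fin.Subset using (Subset)
open import Data.Vec using (lookup)
open import Relation.Binary.PropositionalEquality using (_≡_)

open import Data.Bool using (Bool; true; false; T; not; if_then_else_)
import Data.Bool as Bool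
open import Data.Bool.Properties using (T-≡; T-∧; T-∨)
open import Data.Fin as Fin using (toℕ)
open import Data.Fin.Properties using (all?; toℕ<n; toℕ-injective)
open import Data.Fin.Subset using (_∈_; _∉_; _⊆_; _∪_; ⁅_⁆; ∣_∣; ⋃; inside; outside)
open import Data.Fin.Subset.Properties
  using (_∈?_; _⊆?_; ⊆-trans; ⊆-antisym; x∈p∪q⁺; x∈p∪q⁻; x∈⁅x⁆; x∈⁅y⁆⇒x≡y; ∉⊥; in⊆in-⇔; out⊆-⇔; ∣p∣≤n)
open import Data.Integer using (_-_; _⊖_)
open import Data.Integer.Properties using ([+m]-[+n]≡m⊖n; ⊖-≥)
open import Data.List as List using (List; []; _∷_; map; filter; length; foldl; allFin; _++_)
open import Data.List.Properties using (filter-≐; filter-none; filter-++; length-++)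
open import Data.List.Membership.Propositional using (find; lose)
open import Data.List.Membership.Propositional.Properties using (∈-filter⁺; ∈-filter⁻; ∈-allFin)
open import Data.List.Relation.Unary.All using (universal)
open import Data.List.Relation.Unary.Any using (Any; here; there)
open import Data.List.Relation.Unary.Any.Properties using (map⁺; map⁻)
open import Data.Nat using (suc; zero; _+_; _^_; _∸_; _<_; _<ᵇ_; _<?_)
open import Data.Nat.Properties
  using (+-suc; +-identityʳ; +-∸-assoc; m≤m+n; m+n∸m≡n; <ᵇ⇒<; <⇒<ᵇ; <-irrefl; m<n⇒m<1+n; n<1+n; m<1+n⇒m<n∨m≡n)
open import Data.Product using (∃-syntax; _×_; _,_; proj₁; proj₂)
open import Data.Sum using (_⊎_; inj₁; inj₂; [_,_]′)
open import Data.Unit using (tt)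
open import Data.Vec using ([]; _∷_; here; tabulate)
open import Data.Vec.Properties using (≡-dec; []=⇒lookup; lookup⇒[]=; lookup∘tabulate)
open import Function using (id; _∘_)
open import Function.Bundles using (_⇔_; mk⇔; Equivalence)
open import Function.Construct.Composition using (_⇔-∘_)
open import Relation.Binary.PropositionalEquality using (_≢_; refl; sym; trans; cong; cong₂; subst; module ≡-Reasoning)
open import Relation.Nullary using (¬_; does; yes; no; contradiction)
open import Relation.Nullary.Decidable using (⌊_⌋; toWitness; fromWitness; _×-dec_; _→-dec_)
open import Relation.Unary using (Pred; Decidable)
open import Relation.Unary.Properties using (_∩?_; ∁?)

open Equivalence using (to; from)
open ≡-Reasoning

T-not : ∀ {b} → T (not b) ⇔ (¬ T b)
T-not {true}  = mk⇔ (λ ()) (λ ¬tt → ¬tt tt)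
T-not {false} = mk⇔ (λ _ ()) (λ _ → tt)

T-<ᵇ : ∀ {m n} → T (m <ᵇ n) ⇔ m < n
T-<ᵇ {m} {n} = mk⇔ (<ᵇ⇒< m n) <⇒<ᵇ

+[m+n]-+m≡+n : ∀ m n → + (m + n) - + m ≡ + n
+[m+n]-+m≡+n m n = begin
  + (m + n) - + m ≡⟨ [+m]-[+n]≡m⊖n (m + n) m ⟩
  (m + n) ⊖ m     ≡⟨ ⊖-≥ (m≤m+n m n) ⟩
  + (m + n ∸ m)   ≡⟨ cong +_ (m+n∸m≡n m n) ⟩
  + n             ∎

module _ {n : ℕ} where

  ∈⇔T-lookup : ∀ {p : Subset n} {j} → j ∈ p ⇔ T (lookup p j)
  ∈⇔T-lookup {p} {j} = mk⇔ (from T-≡ ∘ []=⇒lookup) (lookup⇒[]= j p ∘ to T-≡)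

  ∈-tabulate : ∀ {f : Fin n → Bool} {j} → j ∈ tabulate f ⇔ T (f j)
  ∈-tabulate {f} {j} = mk⇔ (subst T (lookup∘tabulate f j) ∘ to ∈⇔T-lookup)
                           (from ∈⇔T-lookup ∘ subst T (sym (lookup∘tabulate f j)))

  ∈-tabulate-⌊⌋ : ∀ {ℓ} {P : Pred (Fin n) ℓ} (P? : Decidable P) {j} →
                    j ∈ tabulate (λ m → ⌊ P? m ⌋) ⇔ P j
  ∈-tabulate-⌊⌋ P? {j} = mk⇔ (toWitness {a? = P? j}) fromWitness ⇔-∘ ∈-tabulate

  ∈-⋃ : ∀ {x : Fin n} (ps : List (Subset n)) → x ∈ ⋃ ps ⇔ Any (x ∈_) ps
  ∈-⋃ ps = mk⇔ (⋃⁻ ps) (⋃⁺ ps)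
    where
    ⋃⁻ : ∀ {x} ps → x ∈ ⋃ ps → Any (x ∈_) ps
    ⋃⁻ []       x∈ = contradiction x∈ ∉⊥
    ⋃⁻ (p ∷ ps) x∈ = [ here , there ∘ ⋃⁻ ps ]′ (x∈p∪q⁻ p (⋃ ps) x∈)

    ⋃⁺ : ∀ {x} ps → Any (x ∈_) ps → x ∈ ⋃ ps
    ⋃⁺ (p ∷ ps) (here x∈p)   = x∈p∪q⁺ (inj₁ x∈p)
    ⋃⁺ (p ∷ ps) (there x∈ps) = x∈p∪q⁺ (inj₂ (⋃⁺ ps x∈ps))

count : ∀ {a p} {A : Set a} {P : Pred A p} → Decidable P → List A → ℕ
count P? xs = length (filter P? xs)

module _ {a} {A : Set a} where

  module _ {p q} {P : Pred A p} {Q : Pred A q} (P? : Decidable P) (Q? : Decidable Q) where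

    count-cong : (∀ x → P x ⇔ Q x) → ∀ xs → count P? xs ≡ count Q? xs
    count-cong P⇔Q xs = cong length (filter-≐ P? Q? ((λ {x} → to (P⇔Q x)) , (λ {x} → from (P⇔Q x))) xs)

    count-split : ∀ xs → count P? xs ≡ count (P? ∩? Q?) xs + count (P? ∩? ∁? Q?) xs
    count-split []       = refl
    count-split (x ∷ xs) with does (P? x) | does (Q? x)
    ... | true  | true  = cong suc (count-split xs)
    ... | true  | false = trans (cong suc (count-split xs)) (sym (+-suc _ _))
    ... | false | _     = count-split xs

  module _ {p} {P : Pred A p} (P? : Decidable P) where

    count-none : (∀ x → ¬ P x) → ∀ xs → count P? xs ≡ 0
    count-none ¬P xs = cong length (filter-none P? (universal ¬P xs))

    count-++ : ∀ xs ys → count P? (xs ++ ys) ≡ count P? xs + count P? ys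
    count-++ xs ys = trans (cong length (filter-++ P? xs ys)) (length-++ (filter P? xs))

    count-map : ∀ {B : Set a} (f : B → A) xs → count P? (map f xs) ≡ count (λ x → P? (f x)) xs
    count-map f []       = refl
    count-map f (x ∷ xs) with does (P? (f x))
    ... | true  = cong suc (count-map f xs)
    ... | false = count-map f xs

count-supersets : ∀ N (U : Subset N) → count (U ⊆?_) (allTransactions N) ≡ 2 ^ (N ∸ ∣ U ∣)
count-supersets zero    []      = refl
count-supersets (suc N) (u ∷ U) = begin
  count ((u ∷ U) ⊆?_) (map (inside ∷_) ts ++ map (outside ∷_) ts)
    ≡⟨ count-++ ((u ∷ U) ⊆?_) (map (inside ∷_) ts) _ ⟩
  count ((u ∷ U) ⊆?_) (map (inside ∷_) ts) + count ((u ∷ U) ⊆?_) (map (outside ∷_) ts)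
    ≡⟨ cong₂ _+_ (count-map ((u ∷ U) ⊆?_) (inside ∷_) ts) (count-map ((u ∷ U) ⊆?_) (outside ∷_) ts) ⟩
  count (λ t → (u ∷ U) ⊆? (inside ∷ t)) ts + count (λ t → (u ∷ U) ⊆? (outside ∷ t)) ts
    ≡⟨ halves u ⟩
  2 ^ (suc N ∸ ∣ u ∷ U ∣) ∎
  where
  ts = allTransactions N

  outside-head : ∀ {s} → (∀ {t : Subset N} → U ⊆ t ⇔ (outside ∷ U) ⊆ (s ∷ t)) →
          count (λ t → (outside ∷ U) ⊆? (s ∷ t)) ts ≡ 2 ^ (N ∸ ∣ U ∣)
  outside-head ⇔⊆ = trans (sym (count-cong (U ⊆?_) _ (λ _ → ⇔⊆) ts)) (count-supersets N U)

  halves : ∀ u → count (λ t → (u ∷ U) ⊆? (inside ∷ t)) ts + count (λ t → (u ∷ U) ⊆? (outside ∷ t)) ts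
                 ≡ 2 ^ (suc N ∸ ∣ u ∷ U ∣)
  halves inside = begin
    count (λ t → (inside ∷ U) ⊆? (inside ∷ t)) ts + count (λ t → (inside ∷ U) ⊆? (outside ∷ t)) ts
      ≡⟨ cong₂ _+_ (trans (sym (count-cong (U ⊆?_) _ (λ _ → in⊆in-⇔) ts)) (count-supersets N U))
                   (count-none _ (λ _ ⊆outside → contradiction (⊆outside here) λ ()) ts) ⟩
    2 ^ (N ∸ ∣ U ∣) + 0
      ≡⟨ +-identityʳ _ ⟩
    2 ^ (N ∸ ∣ U ∣) ∎
  halves outside = begin
    count (λ t → (outside ∷ U) ⊆? (inside ∷ t)) ts + count (λ t → (outside ∷ U) ⊆? (outside ∷ t)) ts
      ≡⟨ cong₂ _+_ (outside-head out⊆-⇔) (outside-head out⊆-⇔) ⟩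
    2 ^ (N ∸ ∣ U ∣) + 2 ^ (N ∸ ∣ U ∣)
      ≡⟨ cong (λ m → 2 ^ (N ∸ ∣ U ∣) + m) (sym (+-identityʳ _)) ⟩
    2 ^ suc (N ∸ ∣ U ∣)
      ≡⟨ cong (2 ^_) (sym (+-∸-assoc 1 (∣p∣≤n U))) ⟩
    2 ^ (suc N ∸ ∣ U ∣) ∎

module _ {a ℓ} {A : Set a} {k : ℕ} (Inv : ℕ → A → Set ℓ) (f : A → Fin k → A)
         (f-preserves : ∀ i e → Inv (toℕ i) e → Inv (suc (toℕ i)) (f e i)) where

  foldl-tabulate-induction : ∀ {m} n (g : Fin m → Fin k) → (∀ j → toℕ (g j) ≡ n + toℕ j) →
                             ∀ {e} → Inv n e → Inv (n + m) (foldl f e (List.tabulate g))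
  foldl-tabulate-induction {zero}  n g g-shift {e} inv = subst (λ m → Inv m e) (sym (+-identityʳ n)) inv
  foldl-tabulate-induction {suc m} n g g-shift {e} inv =
    subst (λ m′ → Inv m′ (foldl f (f e (g Fin.zero)) (List.tabulate (g ∘ Fin.suc)))) (sym (+-suc n m))
      (foldl-tabulate-induction (suc n) (g ∘ Fin.suc) (λ j → trans (g-shift (Fin.suc j)) (+-suc n (toℕ j)))
        (subst (λ m → Inv (suc m) (f e (g Fin.zero))) g₀≡n
          (f-preserves (g Fin.zero) e (subst (λ m → Inv m e) (sym g₀≡n) inv))))
    where
    g₀≡n : toℕ (g Fin.zero) ≡ n
    g₀≡n = trans (g-shift Fin.zero) (+-identityʳ n)

  foldl-allFin-induction : ∀ {e} → Inv 0 e → Inv k (foldl f e (allFin k))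
  foldl-allFin-induction = foldl-tabulate-induction 0 id (λ _ → refl)

module _ {N k : ℕ} (C : Collection N k) where

  ∈-sets : ∀ {t j} → j ∈ sets C t ⇔ lookup C j ⊆ t
  ∈-sets {t} = ∈-tabulate-⌊⌋ (λ m → lookup C m ⊆? t)

  ∈-closure : ∀ G {j} → j ∈ closure C G ⇔ lookup C j ⊆ union C G
  ∈-closure G = ∈-tabulate-⌊⌋ (λ m → lookup C m ⊆? union C G)

  Any-members⁺ : ∀ {p} {P : Pred (Subset N) p} {G m} → m ∈ G → P (lookup C m) → Any P (members C G)
  Any-members⁺ {G = G} {m} m∈G Pm =
    map⁺ (lose (∈-filter⁺ (λ j → lookup G j Bool.≟ true) (∈-allFin m) ([]=⇒lookup m∈G)) Pm)

  Any-members⁻ : ∀ {p} {P : Pred (Subset N) p} G → Any P (members C G) → ∃[ m ] m ∈ G × P (lookup C m)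
  Any-members⁻ G any =
    let m , m∈ , Pm = find (map⁻ {xs = filter member? (allFin k)} any)
    in m , lookup⇒[]= m G (proj₂ (∈-filter⁻ member? {xs = allFin k} m∈)) , Pm
    where
    member? : Decidable (λ j → lookup G j ≡ true)
    member? j = lookup G j Bool.≟ true

  ⊆-union : ∀ {G m} → m ∈ G → lookup C m ⊆ union C G
  ⊆-union {G} m∈G x∈ = from (∈-⋃ (members C G)) (Any-members⁺ m∈G x∈)

  union-⊆ : ∀ G {u} → (∀ {m} → m ∈ G → lookup C m ⊆ u) → union C G ⊆ u
  union-⊆ G bounded x∈ = let _ , m∈G , x∈m = Any-members⁻ G (to (∈-⋃ (members C G)) x∈) in bounded m∈G x∈m

  ⊆-closure : ∀ G → G ⊆ closure C G
  ⊆-closure G m∈G = from (∈-closure G) (⊆-union m∈G)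

  closure-bounded : ∀ G {u} → (∀ {m} → m ∈ G → lookup C m ⊆ u) →
                    ∀ {j} → j ∈ closure C G → lookup C j ⊆ u
  closure-bounded G bounded j∈ x∈ = union-⊆ G bounded (to (∈-closure G) j∈ x∈)

  closure-⊆-sets : ∀ {G t} → G ⊆ sets C t → closure C G ⊆ sets C t
  closure-⊆-sets {G} G⊆ j∈ = from ∈-sets (closure-bounded G (λ m∈G → to ∈-sets (G⊆ m∈G)) j∈)

  closure-⊆-closure : ∀ {G H} → H ⊆ closure C G → closure C H ⊆ closure C G
  closure-⊆-closure {G} {H} H⊆ j∈ =
    from (∈-closure G) (closure-bounded H (λ m∈H → to (∈-closure G) (H⊆ m∈H)) j∈)

  ∈-jclosure⁻ : ∀ G n {j} → j ∈ jclosure C G n → j ∈ G ⊎ (j ∈ closure C G × ¬ toℕ j < n)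
  ∈-jclosure⁻ G n j∈ with to T-∨ (to ∈-tabulate j∈)
  ... | inj₁ j∈G  = inj₁ (from ∈⇔T-lookup j∈G)
  ... | inj₂ rest = let j∈cl , ≮ = to T-∧ rest in
                    inj₂ (from ∈⇔T-lookup j∈cl , λ lt → to T-not ≮ (from T-<ᵇ lt))

  ∈-jclosure⁺ : ∀ G n {j} → j ∈ G ⊎ (j ∈ closure C G × ¬ toℕ j < n) → j ∈ jclosure C G n
  ∈-jclosure⁺ G n (inj₁ j∈G)        = from ∈-tabulate (from T-∨ (inj₁ (to ∈⇔T-lookup j∈G)))
  ∈-jclosure⁺ G n (inj₂ (j∈cl , ≮)) =
    from ∈-tabulate (from T-∨ (inj₂ (from T-∧ (to ∈⇔T-lookup j∈cl ,
                                               from T-not (λ lt → ≮ (to T-<ᵇ lt))))))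

  ⊆-jclosure : ∀ G n → G ⊆ jclosure C G n
  ⊆-jclosure G n j∈G = ∈-jclosure⁺ G n (inj₁ j∈G)

  jclosure-⊆-closure : ∀ G n → jclosure C G n ⊆ closure C G
  jclosure-⊆-closure G n j∈ = [ ⊆-closure G , proj₁ ]′ (∈-jclosure⁻ G n j∈)

  jclosure-prefix : ∀ G n {j} → j ∈ jclosure C G n → toℕ j < n → j ∈ G
  jclosure-prefix G n j∈ lt = [ id , (λ (_ , ≮) → contradiction lt ≮) ]′ (∈-jclosure⁻ G n j∈)

  Matches : ℕ → Subset k → Subset N → Set
  Matches n G t = G ⊆ sets C t × (∀ j → toℕ j < n → j ∈ sets C t → j ∈ G)

  matches? : ∀ n G → Decidable (Matches n G)
  matches? n G t = G ⊆? sets C t ×-dec all? (λ j → toℕ j <? n →-dec (j ∈? sets C t →-dec j ∈? G))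

  matches-zero : ∀ {G t} → Matches 0 G t ⇔ union C G ⊆ t
  matches-zero {G} {t} = mk⇔ ⇒ ⇐
    where
    ⇒ : Matches 0 G t → union C G ⊆ t
    ⇒ (G⊆ , _) = union-⊆ G (λ m∈G → to ∈-sets (G⊆ m∈G))
    ⇐ : union C G ⊆ t → Matches 0 G t
    ⇐ ⋃G⊆t = (λ m∈G → from ∈-sets (⊆-trans (⊆-union m∈G) ⋃G⊆t)) , λ _ ()

  matches-all : ∀ {G t} → Matches k G t ⇔ (sets C t ≡ G)
  matches-all = mk⇔ (λ (G⊆ , exact) → ⊆-antisym (λ {j} → exact j (toℕ<n j)) G⊆)
                    (λ { refl → id , λ _ _ → id })

  matches-suc : ∀ {i G t} → Matches (suc (toℕ i)) G t ⇔ (Matches (toℕ i) G t × (i ∈ sets C t → i ∈ G))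
  matches-suc {i} {G} {t} = mk⇔
    (λ (G⊆ , exact) → (G⊆ , λ j → exact j ∘ m<n⇒m<1+n) , exact i (n<1+n (toℕ i)))
    (λ ((G⊆ , exact) , i-exact) → G⊆ , λ j lt →
      [ exact j , (λ j≡i → subst (λ j → j ∈ sets C t → j ∈ G) (sym (toℕ-injective j≡i)) i-exact) ]′
      (m<1+n⇒m<n∨m≡n lt))

  matches-insert : ∀ {i G t} → (Matches (toℕ i) G t × i ∈ sets C t) ⇔ Matches (toℕ i) (G ∪ ⁅ i ⁆) t
  matches-insert {i} {G} {t} = mk⇔ ⇒ ⇐
    where
    ⇒ : Matches (toℕ i) G t × i ∈ sets C t → Matches (toℕ i) (G ∪ ⁅ i ⁆) t
    ⇒ ((G⊆ , exact) , i∈) = G∪i⊆ , λ j lt j∈ → x∈p∪q⁺ (inj₁ (exact j lt j∈))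
      where
      G∪i⊆ : G ∪ ⁅ i ⁆ ⊆ sets C t
      G∪i⊆ {j} j∈ = [ G⊆ , (λ j∈⁅i⁆ → subst (_∈ sets C t) (sym (x∈⁅y⁆⇒x≡y i j∈⁅i⁆)) i∈) ]′
                      (x∈p∪q⁻ G ⁅ i ⁆ j∈)

    ⇐ : Matches (toℕ i) (G ∪ ⁅ i ⁆) t → Matches (toℕ i) G t × i ∈ sets C t
    ⇐ (G∪i⊆ , exact) =
      ((λ j∈G → G∪i⊆ (x∈p∪q⁺ (inj₁ j∈G))) , exact′) , G∪i⊆ (x∈p∪q⁺ (inj₂ (x∈⁅x⁆ i)))
      where
      exact′ : ∀ j → toℕ j < toℕ i → j ∈ sets C t → j ∈ G
      exact′ j lt j∈ = [ id , (λ j∈⁅i⁆ → contradiction lt (<-irrefl (cong toℕ (x∈⁅y⁆⇒x≡y i j∈⁅i⁆)))) ]′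
                         (x∈p∪q⁻ G ⁅ i ⁆ (exact j lt j∈))

  matches-jclosure : ∀ {n H t} → Matches n H t ⇔ Matches n (jclosure C H n) t
  matches-jclosure {n} {H} = mk⇔
    (λ (H⊆ , exact) → (λ j∈ → closure-⊆-sets H⊆ (jclosure-⊆-closure H n j∈)) ,
                      λ j lt j∈ → ⊆-jclosure H n (exact j lt j∈))
    (λ (J⊆ , exact) → (λ j∈ → J⊆ (⊆-jclosure H n j∈)) ,
                      λ j lt j∈ → jclosure-prefix H n (exact j lt j∈) lt)

  jclosure-closed : ∀ H n {t} → Matches n (jclosure C H n) t → closure C (jclosure C H n) ≡ jclosure C H n
  jclosure-closed H n (J⊆ , exact) = ⊆-antisym closed (⊆-closure (jclosure C H n))
    where
    closed : closure C (jclosure C H n) ⊆ jclosure C H n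
    closed {j} j∈ with toℕ j <? n
    ... | yes lt = exact j lt (closure-⊆-sets J⊆ j∈)
    ... | no ≮   =
      ∈-jclosure⁺ H n (inj₂ (closure-⊆-closure {H} {jclosure C H n} (jclosure-⊆-closure H n) j∈ , ≮))

  matchCount : ℕ → Subset k → ℕ
  matchCount n G = count (matches? n G) (allTransactions N)

  EstimatesAfter : ℕ → Estimate k → Set
  EstimatesAfter n e = ∀ G → e G ≡ + matchCount n G

  matchCount-zero : ∀ G → matchCount 0 G ≡ 2 ^ (N ∸ ∣ union C G ∣)
  matchCount-zero G = trans (count-cong (matches? 0 G) (union C G ⊆?_) (λ _ → matches-zero) (allTransactions N))
                            (count-supersets N (union C G))

  matchCount-all : ∀ G → matchCount k G ≡ blockSize C G
  matchCount-all G =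
    count-cong (matches? k G) (λ t → ≡-dec Bool._≟_ (sets C t) G) (λ _ → matches-all) (allTransactions N)

  initE-estimates : EstimatesAfter 0 (initE C)
  initE-estimates G = cong +_ (sym (matchCount-zero G))

  -- The paper's 𝒢′ = closure(𝒢 ∪ {X_{i+1}}, i) for 0-based i.
  extend : Subset k → Fin k → Subset k
  extend G i = jclosure C (G ∪ ⁅ i ⁆) (toℕ i)

  matchCount-extend : ∀ {i G} → i ∉ G →
                      matchCount (toℕ i) G ≡ matchCount (toℕ i) (extend G i) + matchCount (suc (toℕ i)) G
  matchCount-extend {i} {G} i∉G =
    trans (count-split (matches? (toℕ i) G) i∈? (allTransactions N))
          (cong₂ _+_ (count-cong (matches? (toℕ i) G ∩? i∈?) (matches? (toℕ i) (extend G i))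
                                 (λ _ → matches-jclosure ⇔-∘ matches-insert) (allTransactions N))
                     (count-cong (matches? (toℕ i) G ∩? ∁? i∈?) (matches? (suc (toℕ i)) G)
                                 (λ _ → excluded) (allTransactions N)))
    where
    i∈? : Decidable (λ t → i ∈ sets C t)
    i∈? t = i ∈? sets C t

    excluded : ∀ {t} → (Matches (toℕ i) G t × i ∉ sets C t) ⇔ Matches (suc (toℕ i)) G t
    excluded = mk⇔ (λ (m , i∉) → from matches-suc (m , λ i∈ → contradiction i∈ i∉))
                   (λ m → let m′ , i-exact = to matches-suc m in m′ , i∉G ∘ i-exact)

  matchCount-unclosed : ∀ {n H} → closure C (jclosure C H n) ≢ jclosure C H n → matchCount n (jclosure C H n) ≡ 0
  matchCount-unclosed {n} {H} unclosed =
    count-none (matches? n (jclosure C H n)) (λ _ matches → unclosed (jclosure-closed H n matches)) (allTransactions N)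

  round-estimates-∉ : ∀ {i e G} → i ∉ G → EstimatesAfter (toℕ i) e →
                      (if isClosed C (extend G i) then e G - e (extend G i) else e G) ≡ + matchCount (suc (toℕ i)) G
  round-estimates-∉ {i} {e} {G} i∉G est with isClosed C (extend G i) in closed
  ... | true = begin
    e G - e (extend G i)
      ≡⟨ cong₂ _-_ (est G) (est (extend G i)) ⟩
    + matchCount (toℕ i) G - + matchCount (toℕ i) (extend G i)
      ≡⟨ cong (λ c → + c - + matchCount (toℕ i) (extend G i)) (matchCount-extend i∉G) ⟩
    + (matchCount (toℕ i) (extend G i) + matchCount (suc (toℕ i)) G) - + matchCount (toℕ i) (extend G i)
      ≡⟨ +[m+n]-+m≡+n (matchCount (toℕ i) (extend G i)) _ ⟩
    + matchCount (suc (toℕ i)) G ∎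
  ... | false = begin
    e G
      ≡⟨ est G ⟩
    + matchCount (toℕ i) G
      ≡⟨ cong +_ (matchCount-extend i∉G) ⟩
    + (matchCount (toℕ i) (extend G i) + matchCount (suc (toℕ i)) G)
      ≡⟨ cong (λ c → + (c + matchCount (suc (toℕ i)) G))
              (matchCount-unclosed {toℕ i} {G ∪ ⁅ i ⁆} unclosed) ⟩
    + matchCount (suc (toℕ i)) G ∎
    where
    unclosed : closure C (extend G i) ≢ extend G i
    unclosed is-closed = subst T closed (fromWitness is-closed)

  round-estimates : ∀ i e → EstimatesAfter (toℕ i) e → EstimatesAfter (suc (toℕ i)) (step C i e)
  round-estimates i e est G with lookup G i in i∈G?
  ... | true  = trans (est G) (cong +_ (count-cong (matches? (toℕ i) G) (matches? (suc (toℕ i)) G)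
                                                    (λ _ → kept) (allTransactions N)))
    where
    kept : ∀ {t} → Matches (toℕ i) G t ⇔ Matches (suc (toℕ i)) G t
    kept = mk⇔ (λ m → from matches-suc (m , λ _ → lookup⇒[]= i G i∈G?)) (proj₁ ∘ to matches-suc)
  ... | false = round-estimates-∉ (λ i∈G → contradiction (trans (sym ([]=⇒lookup i∈G)) i∈G?) λ ()) est

  qieBlockSizes-estimates : EstimatesAfter k (qieBlockSizes C)
  qieBlockSizes-estimates = foldl-allFin-induction EstimatesAfter (λ e i → step C i e) round-estimates initE-estimates

theorem4p18 : (N k : ℕ) (C : Collection N k) →
    (∀ i j → lookup C i ≡ lookup C j → i ≡ j) →
    (t : Subset N) →
    qieBlockSizes C (sets C t) ≡ + blockSize C (sets C t)
-- The X_i need not be distinct: subcollections are sets of indices.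
theorem4p18 N k C _ t = begin
  qieBlockSizes C (sets C t)  ≡⟨ qieBlockSizes-estimates C (sets C t) ⟩
  + matchCount C k (sets C t) ≡⟨ cong +_ (matchCount-all C (sets C t)) ⟩
  + blockSize C (sets C t)    ∎
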